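{- For all integers $k\ge 1$ and $n\ge 1$, $\chi_{la}\big((2k)P_2\vee O_{2n}\big)=3$.
   Context: For a graph $G$ with $q$ edges, a local antimagic labeling is a bijection $f:E(G)\to\{1,\dots,q\}$ such that, writing $f^+(u)=\sum_{e\ni u}f(e)$ (the sum of labels of edges incident to $u$), we have $f^+(u)\ne f^+(v)$ for every edge $uv$. The local antimagic chromatic number $\chi_{la}(G)$ is the minimum, over all local antimagic labelings $f$ of $G$, of the number of distinct values of $f^+$. $P_2$ is the path with one edge, $aP_2$ is the disjoint union of $a$ copies of $P_2$ (a 1-regular graph), $O_m$ is the null (edgeless) graph on $m$ vertices, and $G\vee H$ is the join of $G$ and $H$ (disjoint union plus all edges between $V(G)$ and $V(H)$). -}

module Defs where

open import Data.Nat using (ℕ; zero; suc; _+_; _*_; _≤_)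
open import Data.Fin using (Fin; toℕ; _↑ˡ_; _↑ʳ_; combine; _≟_)
open import Data.List using (List; []; _∷_; _++_; map; concatMap; length; allFin; lookup; deduplicate)
open import Data.Product using (_×_; _,_; proj₁; proj₂; Σ; ∃)
open import Data.Bool using (if_then_else_; _∨_)
open import Relation.Nullary.Decidable using (⌊_⌋)
open import Relation.Binary.PropositionalEquality using (_≡_; _≢_)
open import Function.Definitions using (Bijective)
import Data.Nat as ℕ

record Graph : Set where
  field
    V     : ℕ
    edges : List (Fin V × Fin V)

open Graph public

size : Graph → ℕ
size G = length (edges G)

edge : (G : Graph) → Fin (size G) → Fin (V G) × Fin (V G)
edge G e = lookup (edges G) e

sumFin : (n : ℕ) → (Fin n → ℕ) → ℕ
sumFin zero    g = 0
sumFin (suc n) g = g Fin.zero + sumFin n (λ i → g (Fin.suc i))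
  where import Data.Fin as Fin

-- An edge labeling: a bijection E(G) → {1,…,q}.  We represent it as a
-- bijection ℓ : Fin q → Fin q; the label of edge e is toℕ (ℓ e) + 1.
Labeling : Graph → Set
Labeling G = Σ (Fin (size G) → Fin (size G)) (λ ℓ → Bijective _≡_ _≡_ ℓ)

label : (G : Graph) → Labeling G → Fin (size G) → ℕ
label G (ℓ , _) e = suc (toℕ (ℓ e))

vsum : (G : Graph) → Labeling G → Fin (V G) → ℕ
vsum G f u = sumFin (size G) (λ e →
  if ⌊ proj₁ (edge G e) ≟ u ⌋ ∨ ⌊ proj₂ (edge G e) ≟ u ⌋
  then label G f e else 0)

IsLocalAntimagic : (G : Graph) → Labeling G → Set
IsLocalAntimagic G f =
  (e : Fin (size G)) → vsum G f (proj₁ (edge G e)) ≢ vsum G f (proj₂ (edge G e))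

numColors : (G : Graph) → Labeling G → ℕ
numColors G f = length (deduplicate ℕ._≟_ (map (vsum G f) (allFin (V G))))

ChiLaIs : Graph → ℕ → Set
ChiLaIs G c =
  (Σ (Labeling G) λ f → IsLocalAntimagic G f × numColors G f ≡ c)
  × ((f : Labeling G) → IsLocalAntimagic G f → c ≤ numColors G f)

-- The graph (a P₂) ∨ O_m.  Vertices: Fin (a * 2 + m); the matching
-- vertices are combine i j (i : Fin a, j : Fin 2) embedded on the left,
-- the null-graph vertices are embedded on the right.
matchJoinNull : ℕ → ℕ → Graph
matchJoinNull a m = record
  { V     = a * 2 + m
  ; edges = map matchEdge (allFin a)
            ++ concatMap (λ x → map (λ y → (x ↑ˡ m , (a * 2) ↑ʳ y)) (allFin m))
                         (allFin (a * 2))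
  }
  where
  import Data.Fin as F
  matchEdge : Fin a → Fin (a * 2 + m) × Fin (a * 2 + m)
  matchEdge i = (combine i F.zero ↑ˡ m , combine i (F.suc F.zero) ↑ˡ m)

module Submission where

-- Lower bound: a matching edge u v and a null vertex w form a triangle, so a local antimagic
-- labeling gives u, v and w three different vertex sums.
--
-- Upper bound, for a ≥ 1 matching edges and m = 2n null vertices:
-- labels are values + 1, and the values 0, …, (2m + 1)a − 1 are cut into blocks of a consecutive
-- numbers. Matching edge i gets the value 2am + i of the top block. View the join edges as a 2a × m
-- matrix with the matched vertices as rows and the null vertices as columns. The special column 0
-- takes the blocks m − 1 and m, in decreasing order down the rows. The regular column y + 1 takes
-- block y on the upper ends and the mirrored block 2m − 1 − y on the lower ends, both at offset
-- α y i, where α y is the identity of [0, a) for even y and its reversal for odd y. Mirrored blocks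
-- give every column the sum 2a²m + a. In the row of an upper or lower end of matching edge i, the
-- 2n − 1 regular columns contribute a constant plus i, the special column a constant minus 2i, and
-- the matching edge a constant plus i, so all upper ends share one sum and all lower ends another;
-- the three sums are pairwise distinct.

open import Defs
open import Data.Nat using (ℕ; zero; suc; _+_; _*_; _∸_; _≤_; _<_; z≤n; s≤s)
import Data.Nat as ℕ
import Data.Nat.Properties as ℕP
open import Data.Nat.Tactic.RingSolver using (solve-∀)
open import Data.Fin using (Fin; toℕ; combine; _↑ˡ_; _↑ʳ_; splitAt; quotient; remainder; fromℕ<)
import Data.Fin as F
import Data.Fin.Properties as FP
open import Data.List using (List; []; _∷_; _++_; map; concatMap; length; allFin; tabulate; lookup; deduplicate)
import Data.List.Properties as LP
open import Data.List.Membership.Propositional using (_∈_)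
import Data.List.Membership.Propositional.Properties as MP
open import Data.List.Relation.Binary.Subset.Propositional using (_⊆_)
open import Data.List.Relation.Unary.Any using (here; there)
import Data.List.Relation.Unary.Any as Any
import Data.List.Relation.Unary.Any.Properties as AnyP
open import Data.List.Relation.Unary.All using ([]; _∷_)
import Data.List.Relation.Unary.All as All
open import Data.List.Relation.Unary.AllPairs using ([]; _∷_)
open import Data.List.Relation.Unary.Unique.Propositional using (Unique)
open import Data.List.Relation.Unary.Unique.DecPropositional.Properties using (deduplicate-!)
open import Data.Product using (_×_; _,_; proj₁; proj₂; Σ; ∃)
open import Data.Sum using (_⊎_; inj₁; inj₂)
open import Data.Bool using (if_then_else_; _∨_)
open import Relation.Binary.PropositionalEquality
open import Relation.Binary.Definitions using (tri<; tri≈; tri>)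
open import Relation.Nullary using (yes; no)
open import Relation.Nullary.Decidable using (⌊_⌋)
open import Data.Empty using (⊥-elim)
open import Data.Nat.DivMod using (_/_; _%_; m≡m%n+[m/n]*n; m%n<n; m<n*o⇒m/o<n)
open import Data.Nat.Divisibility using (_∣_; ∣m+n∣m⇒∣n; m∣m*n; ∣1⇒≡1; ∣⇒≤)
open import Function using (_∘_)
open import Function.Definitions using (Injective; StrictlySurjective)
open import Function.Consequences.Propositional using (strictlySurjective⇒surjective)

sumFin-cong : ∀ n {g h : Fin n → ℕ} → (∀ i → g i ≡ h i) → sumFin n g ≡ sumFin n h
sumFin-cong zero    eq = refl
sumFin-cong (suc n) eq = cong₂ _+_ (eq F.zero) (sumFin-cong n (eq ∘ F.suc))

sumFin-const : ∀ n c → sumFin n (λ _ → c) ≡ n * c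
sumFin-const zero    c = refl
sumFin-const (suc n) c = cong (c +_) (sumFin-const n c)

sumFin-+ : ∀ n (g h : Fin n → ℕ) → sumFin n (λ i → g i + h i) ≡ sumFin n g + sumFin n h
sumFin-+ zero    g h = refl
sumFin-+ (suc n) g h =
  trans (cong (g F.zero + h F.zero +_) (sumFin-+ n (g ∘ F.suc) (h ∘ F.suc)))
        (interchange (g F.zero) (h F.zero) _ _)
  where
  interchange : ∀ a b c d → (a + b) + (c + d) ≡ (a + c) + (b + d)
  interchange = solve-∀

sumFin-↑ : ∀ p q (g : Fin (p + q) → ℕ) →
           sumFin (p + q) g ≡ sumFin p (g ∘ (_↑ˡ q)) + sumFin q (g ∘ (p ↑ʳ_))
sumFin-↑ zero    q g = refl
sumFin-↑ (suc p) q g =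
  trans (cong (g F.zero +_) (sumFin-↑ p q (g ∘ F.suc))) (sym (ℕP.+-assoc (g F.zero) _ _))

sumFin-combine : ∀ n k (g : Fin (n * k) → ℕ) →
                 sumFin (n * k) g ≡ sumFin n (λ i → sumFin k (λ j → g (combine i j)))
sumFin-combine zero    k g = refl
sumFin-combine (suc n) k g =
  trans (sumFin-↑ k (n * k) g) (cong (sumFin k (g ∘ (_↑ˡ n * k)) +_) (sumFin-combine n k (g ∘ (k ↑ʳ_))))

sumFin-zero : ∀ n {g : Fin n → ℕ} → (∀ i → g i ≡ 0) → sumFin n g ≡ 0
sumFin-zero n g≡0 = trans (sumFin-cong n g≡0) (trans (sumFin-const n 0) (ℕP.*-zeroʳ n))

sumFin-single : ∀ n {g : Fin n → ℕ} (i₀ : Fin n) → (∀ i → i ≢ i₀ → g i ≡ 0) → sumFin n g ≡ g i₀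
sumFin-single (suc n) {g} F.zero     g≡0 =
  trans (cong (g F.zero +_) (sumFin-zero n (λ i → g≡0 (F.suc i) λ ()))) (ℕP.+-identityʳ _)
sumFin-single (suc n) {g} (F.suc i₀) g≡0 =
  trans (cong (_+ sumFin n (g ∘ F.suc)) (g≡0 F.zero λ ()))
        (sumFin-single n i₀ (λ i i≢i₀ → g≡0 (F.suc i) (i≢i₀ ∘ FP.suc-injective)))

sumFin-*ˡ : ∀ n c (g : Fin n → ℕ) → sumFin n (λ i → c * g i) ≡ c * sumFin n g
sumFin-*ˡ zero    c g = sym (ℕP.*-zeroʳ c)
sumFin-*ˡ (suc n) c g =
  trans (cong (c * g F.zero +_) (sumFin-*ˡ n c (g ∘ F.suc))) (sym (ℕP.*-distribˡ-+ c (g F.zero) _))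

sum< : ℕ → (ℕ → ℕ) → ℕ
sum< n f = sumFin n (f ∘ toℕ)

sum<-cong : ∀ n {f g : ℕ → ℕ} → (∀ y → y < n → f y ≡ g y) → sum< n f ≡ sum< n g
sum<-cong n eq = sumFin-cong n (λ i → eq (toℕ i) (FP.toℕ<n i))

sum<-suc : ∀ n f → sum< (suc n) f ≡ sum< n f + f n
sum<-suc zero    f = ℕP.+-comm (f 0) 0
sum<-suc (suc n) f = trans (cong (f 0 +_) (sum<-suc n (f ∘ suc))) (sym (ℕP.+-assoc (f 0) _ _))

gauss : ∀ n → 2 * sum< n (λ y → y) + n ≡ n * n
gauss zero    = refl
gauss (suc n) = begin
  2 * sum< (suc n) (λ y → y) + suc n ≡⟨ cong (λ s → 2 * s + suc n) (sum<-suc n (λ y → y)) ⟩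
  2 * (S + n) + suc n                ≡⟨ regroup S n ⟩
  (2 * S + n) + (2 * n + 1)          ≡⟨ cong (_+ (2 * n + 1)) (gauss n) ⟩
  n * n + (2 * n + 1)                ≡⟨ square-suc n ⟩
  suc n * suc n                      ∎
  where
  open ≡-Reasoning
  S : ℕ
  S = sum< n (λ y → y)
  regroup : ∀ s n → 2 * (s + n) + suc n ≡ (2 * s + n) + (2 * n + 1)
  regroup = solve-∀
  square-suc : ∀ n → n * n + (2 * n + 1) ≡ suc n * suc n
  square-suc = solve-∀

sum<-linear : ∀ n c (g : ℕ → ℕ) → sum< n (λ y → suc (c * y + g y)) ≡ c * sum< n (λ y → y) + sum< n g + n
sum<-linear n c g = begin
  sum< n (λ y → suc (c * y + g y))                         ≡⟨ sumFin-cong n (λ y → ℕP.+-comm 1 _) ⟩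
  sumFin n (λ y → (c * toℕ y + g (toℕ y)) + 1)            ≡⟨ sumFin-+ n _ _ ⟩
  sumFin n (λ y → c * toℕ y + g (toℕ y)) + sumFin n (λ _ → 1)
    ≡⟨ cong₂ _+_ (trans (sumFin-+ n _ _) (cong (_+ sum< n g) (sumFin-*ˡ n c toℕ)))
                 (trans (sumFin-const n 1) (ℕP.*-identityʳ n)) ⟩
  c * sum< n (λ y → y) + sum< n g + n                      ∎
  where open ≡-Reasoning

sum<-reverse : ∀ n → sum< n (λ i → n ∸ suc i) ≡ sum< n (λ i → i)
sum<-reverse zero    = refl
sum<-reverse (suc n) = trans (cong (n +_) (sum<-reverse n))
                             (trans (ℕP.+-comm n _) (sym (sum<-suc n (λ i → i))))

sum<-odd : ∀ p → sum< (suc (2 * p)) (λ y → y) ≡ p * suc (2 * p)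
sum<-odd p = ℕP.*-cancelˡ-≡ _ _ 2 (ℕP.+-cancelʳ-≡ (suc (2 * p)) _ _
  (trans (gauss (suc (2 * p))) (square-odd p)))
  where
  square-odd : ∀ p → suc (2 * p) * suc (2 * p) ≡ 2 * (p * suc (2 * p)) + suc (2 * p)
  square-odd = solve-∀

reflect-< : ∀ {i n} → i < n → n ∸ suc i < n
reflect-< {i} {n} i<n = ℕP.∸-monoʳ-< (s≤s z≤n) i<n

reflect-involutive : ∀ {i n} → i < n → n ∸ suc (n ∸ suc i) ≡ i
reflect-involutive {i} {n} i<n = begin
  n ∸ suc (n ∸ suc i)                 ≡⟨ cong (_∸ suc (n ∸ suc i)) (ℕP.m∸n+n≡m i<n) ⟨
  (n ∸ suc i) + suc i ∸ suc (n ∸ suc i) ≡⟨ cong (_∸ suc (n ∸ suc i)) (ℕP.+-suc (n ∸ suc i) i) ⟩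
  suc (n ∸ suc i) + i ∸ suc (n ∸ suc i) ≡⟨ ℕP.m+n∸m≡n (suc (n ∸ suc i)) i ⟩
  i                                   ∎
  where open ≡-Reasoning

reflect-even : ∀ {i n} → i < n → 2 * n ∸ suc (2 * i) ≡ suc (2 * (n ∸ suc i))
reflect-even {i} {n} i<n = begin
  2 * n ∸ suc (2 * i)                     ≡⟨ cong (λ k → 2 * k ∸ suc (2 * i)) (ℕP.m∸n+n≡m i<n) ⟨
  2 * (c + suc i) ∸ suc (2 * i)           ≡⟨ cong (_∸ suc (2 * i)) (split c i) ⟩
  suc (2 * c) + suc (2 * i) ∸ suc (2 * i) ≡⟨ ℕP.m+n∸n≡m (suc (2 * c)) (suc (2 * i)) ⟩
  suc (2 * c)                             ∎
  where
  open ≡-Reasoning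
  c : ℕ
  c = n ∸ suc i
  split : ∀ c i → 2 * (c + suc i) ≡ suc (2 * c) + suc (2 * i)
  split = solve-∀

reflect-odd : ∀ {i n} → i < n → 2 * n ∸ suc (suc (2 * i)) ≡ 2 * (n ∸ suc i)
reflect-odd {i} {n} i<n = begin
  2 * n ∸ suc (suc (2 * i))                     ≡⟨ cong (λ k → 2 * k ∸ suc (suc (2 * i))) (ℕP.m∸n+n≡m i<n) ⟨
  2 * (c + suc i) ∸ suc (suc (2 * i))           ≡⟨ cong (_∸ suc (suc (2 * i))) (split c i) ⟩
  2 * c + suc (suc (2 * i)) ∸ suc (suc (2 * i)) ≡⟨ ℕP.m+n∸n≡m (2 * c) (suc (suc (2 * i))) ⟩
  2 * c                                         ∎
  where
  open ≡-Reasoning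
  c : ℕ
  c = n ∸ suc i
  split : ∀ c i → 2 * (c + suc i) ≡ 2 * c + suc (suc (2 * i))
  split = solve-∀

lsum : ∀ {A : Set} → (A → ℕ) → List A → ℕ
lsum F []       = 0
lsum F (x ∷ xs) = F x + lsum F xs

lsum-lookup : ∀ {A : Set} (F : A → ℕ) xs → sumFin (length xs) (F ∘ lookup xs) ≡ lsum F xs
lsum-lookup F []       = refl
lsum-lookup F (x ∷ xs) = cong (F x +_) (lsum-lookup F xs)

lsum-++ : ∀ {A : Set} (F : A → ℕ) xs ys → lsum F (xs ++ ys) ≡ lsum F xs + lsum F ys
lsum-++ F []       ys = refl
lsum-++ F (x ∷ xs) ys = trans (cong (F x +_) (lsum-++ F xs ys)) (sym (ℕP.+-assoc (F x) _ _))

lsum-map : ∀ {A B : Set} (F : B → ℕ) (g : A → B) xs → lsum F (map g xs) ≡ lsum (F ∘ g) xs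
lsum-map F g []       = refl
lsum-map F g (x ∷ xs) = cong (F (g x) +_) (lsum-map F g xs)

lsum-concatMap : ∀ {A B : Set} (F : B → ℕ) (h : A → List B) xs →
                 lsum F (concatMap h xs) ≡ lsum (lsum F ∘ h) xs
lsum-concatMap F h []       = refl
lsum-concatMap F h (x ∷ xs) =
  trans (lsum-++ F (h x) (concatMap h xs)) (cong (lsum F (h x) +_) (lsum-concatMap F h xs))

lsum-tabulate : ∀ {A : Set} n (F : A → ℕ) (g : Fin n → A) → lsum F (tabulate g) ≡ sumFin n (F ∘ g)
lsum-tabulate zero    F g = refl
lsum-tabulate (suc n) F g = cong (F (g F.zero) +_) (lsum-tabulate n F (g ∘ F.suc))

injective⇒strictlySurjective : ∀ {n} {f : Fin n → Fin n} → Injective _≡_ _≡_ f →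
                               StrictlySurjective _≡_ f
injective⇒strictlySurjective {suc n} {f} inj y with FP.any? (λ x → f x F.≟ y)
... | yes y∈im = y∈im
... | no  y∉im = ⊥-elim (ℕP.1+n≰n (FP.injective⇒≤ punchOut-y-injective))
  where
  y≢f : ∀ x → y ≢ f x
  y≢f x y≡fx = y∉im (x , sym y≡fx)
  punchOut-y-injective : Injective _≡_ _≡_ (λ x → F.punchOut (y≢f x))
  punchOut-y-injective {x} {x′} eq = inj (FP.punchOut-injective (y≢f x) (y≢f x′) eq)

length-≤-⊆ : ∀ {A : Set} {xs ys : List A} → Unique xs → xs ⊆ ys → length xs ≤ length ys
length-≤-⊆ {xs = []}     _             _   = z≤n
length-≤-⊆ {xs = x ∷ xs} (x∉xs ∷ uniq) sub with MP.∈-∃++ (sub (here refl))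
... | ys₁ , ys₂ , refl = begin
  suc (length xs)                 ≤⟨ s≤s (length-≤-⊆ uniq sub′) ⟩
  suc (length (ys₁ ++ ys₂))       ≡⟨ cong suc (LP.length-++ ys₁) ⟩
  suc (length ys₁ + length ys₂)   ≡⟨ ℕP.+-suc (length ys₁) (length ys₂) ⟨
  length ys₁ + length (x ∷ ys₂)   ≡⟨ LP.length-++ ys₁ ⟨
  length (ys₁ ++ x ∷ ys₂)         ∎
  where
  open ℕP.≤-Reasoning
  sub′ : xs ⊆ ys₁ ++ ys₂
  sub′ z∈xs with MP.∈-++⁻ ys₁ (sub (there z∈xs))
  ... | inj₁ z∈ys₁           = MP.∈-++⁺ˡ z∈ys₁
  ... | inj₂ (here refl)     = ⊥-elim (All.lookup x∉xs z∈xs refl)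
  ... | inj₂ (there z∈ys₂)   = MP.∈-++⁺ʳ ys₁ z∈ys₂

colours : (G : Graph) → Labeling G → List ℕ
colours G f = deduplicate ℕ._≟_ (map (vsum G f) (allFin (V G)))

module _ (G : Graph) (f : Labeling G) where

  vsum∈colours : ∀ u → vsum G f u ∈ colours G f
  vsum∈colours u = MP.∈-deduplicate⁺ ℕ._≟_ (MP.∈-map⁺ (vsum G f) (MP.∈-allFin u))

  colour-attained : ∀ {c} → c ∈ colours G f → ∃ λ u → vsum G f u ≡ c
  colour-attained c∈ with MP.∈-map⁻ (vsum G f) (MP.∈-deduplicate⁻ ℕ._≟_ _ c∈)
  ... | u , _ , refl = u , refl

  numColors-≤ : (cs : List ℕ) → (∀ u → vsum G f u ∈ cs) → numColors G f ≤ length cs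
  numColors-≤ cs vsum∈cs = length-≤-⊆ (deduplicate-! ℕ._≟_ _) λ c∈ →
    let u , vsum≡c = colour-attained c∈ in subst (_∈ cs) vsum≡c (vsum∈cs u)

  ≤-numColors : (cs : List ℕ) → Unique cs → (∀ {c} → c ∈ cs → ∃ λ u → vsum G f u ≡ c) →
                length cs ≤ numColors G f
  ≤-numColors cs uniq attained = length-≤-⊆ uniq λ c∈ →
    let u , vsum≡c = attained c∈ in subst (_∈ colours G f) vsum≡c (vsum∈colours u)

  antimagic-at : IsLocalAntimagic G f → ∀ {p} → p ∈ edges G → vsum G f (proj₁ p) ≢ vsum G f (proj₂ p)
  antimagic-at anti p∈ = subst (λ p → vsum G f (proj₁ p) ≢ vsum G f (proj₂ p))
                               (sym (AnyP.lookup-index p∈)) (anti (Any.index p∈))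

  antimagic-intro : (∀ {p} → p ∈ edges G → vsum G f (proj₁ p) ≢ vsum G f (proj₂ p)) → IsLocalAntimagic G f
  antimagic-intro at e = at (MP.∈-lookup e)

  triangle⇒3≤numColors : IsLocalAntimagic G f → ∀ {u v w} →
    (u , v) ∈ edges G → (u , w) ∈ edges G → (v , w) ∈ edges G → 3 ≤ numColors G f
  triangle⇒3≤numColors anti {u} {v} {w} uv uw vw = ≤-numColors (vsum G f u ∷ vsum G f v ∷ vsum G f w ∷ [])
    ((antimagic-at anti uv ∷ antimagic-at anti uw ∷ []) ∷ (antimagic-at anti vw ∷ []) ∷ [] ∷ [])
    λ { (here refl) → u , refl ; (there (here refl)) → v , refl ; (there (there (here refl))) → w , refl }

valuation⇒labeling : (G : Graph) (val : Fin (V G) × Fin (V G) → ℕ) →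
                     (∀ t → t < size G → ∃ λ p → p ∈ edges G × val p ≡ t) →
                     Σ (Labeling G) λ f → ∀ e → label G f e ≡ suc (val (edge G e))
valuation⇒labeling G val hits =
  (ℓ , ℓ-injective , strictlySurjective⇒surjective ℓ-strictlySurjective) , λ e → cong suc (toℕ-ℓ e)
  where
  q : ℕ
  q = size G
  pre : Fin q → Fin q
  pre t = Any.index (proj₁ (proj₂ (hits (toℕ t) (FP.toℕ<n t))))
  val-pre : ∀ t → val (edge G (pre t)) ≡ toℕ t
  val-pre t with p , p∈ , val≡ ← hits (toℕ t) (FP.toℕ<n t) = trans (cong val (sym (AnyP.lookup-index p∈))) val≡
  pre-injective : Injective _≡_ _≡_ pre
  pre-injective {t} {t′} eq =
    FP.toℕ-injective (trans (sym (val-pre t)) (trans (cong (val ∘ edge G) eq) (val-pre t′)))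
  ℓ : Fin q → Fin q
  ℓ e = proj₁ (injective⇒strictlySurjective pre-injective e)
  pre-ℓ : ∀ e → pre (ℓ e) ≡ e
  pre-ℓ e = proj₂ (injective⇒strictlySurjective pre-injective e)
  ℓ-injective : Injective _≡_ _≡_ ℓ
  ℓ-injective {e} {e′} eq = trans (sym (pre-ℓ e)) (trans (cong pre eq) (pre-ℓ e′))
  ℓ-strictlySurjective : StrictlySurjective _≡_ ℓ
  ℓ-strictlySurjective t = pre t , pre-injective (pre-ℓ (pre t))
  toℕ-ℓ : ∀ e → toℕ (ℓ e) ≡ val (edge G e)
  toℕ-ℓ e = trans (sym (val-pre (ℓ e))) (cong (val ∘ edge G) (pre-ℓ e))

incidentWeight : ∀ {n} → Fin n → (Fin n × Fin n → ℕ) → Fin n × Fin n → ℕ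
incidentWeight u W p = if ⌊ proj₁ p F.≟ u ⌋ ∨ ⌊ proj₂ p F.≟ u ⌋ then W p else 0

vsum-incidentWeight : ∀ G f W → (∀ e → label G f e ≡ W (edge G e)) →
                      ∀ u → vsum G f u ≡ lsum (incidentWeight u W) (edges G)
vsum-incidentWeight G f W label≡W u = trans
  (sumFin-cong (size G) λ e →
    cong (λ l → if ⌊ proj₁ (edge G e) F.≟ u ⌋ ∨ ⌊ proj₂ (edge G e) F.≟ u ⌋ then l else 0) (label≡W e))
  (lsum-lookup (incidentWeight u W) (edges G))

module IncidentWeight {n} (W : Fin n × Fin n → ℕ) where

  incidentWeight-≢ : ∀ u p → proj₁ p ≢ u → proj₂ p ≢ u → incidentWeight u W p ≡ 0
  incidentWeight-≢ u p ≢₁ ≢₂ with proj₁ p F.≟ u | proj₂ p F.≟ u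
  ... | yes ≡₁ | _      = ⊥-elim (≢₁ ≡₁)
  ... | no _   | yes ≡₂ = ⊥-elim (≢₂ ≡₂)
  ... | no _   | no _   = refl

  incidentWeight-₁ : ∀ u p → proj₁ p ≡ u → incidentWeight u W p ≡ W p
  incidentWeight-₁ u p ≡₁ with proj₁ p F.≟ u
  ... | yes _  = refl
  ... | no ≢₁  = ⊥-elim (≢₁ ≡₁)

  incidentWeight-₂ : ∀ u p → proj₂ p ≡ u → incidentWeight u W p ≡ W p
  incidentWeight-₂ u p ≡₂ with proj₁ p F.≟ u | proj₂ p F.≟ u
  ... | yes _ | _      = refl
  ... | no _  | yes _  = refl
  ... | no _  | no ≢₂  = ⊥-elim (≢₂ ≡₂)

module MatchJoinNull (a m : ℕ) where

  G : Graph
  G = matchJoinNull a m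

  Vertex : Set
  Vertex = Fin (V G)

  matched : Fin a → Fin 2 → Vertex
  matched i j = combine i j ↑ˡ m

  null : Fin m → Vertex
  null y = (a * 2) ↑ʳ y

  matchEdge : Fin a → Vertex × Vertex
  matchEdge i = (matched i F.zero , matched i (F.suc F.zero))

  joinEdge : Fin (a * 2) → Fin m → Vertex × Vertex
  joinEdge x y = (x ↑ˡ m , null y)

  ↑ˡ≢null : ∀ x y → x ↑ˡ m ≢ null y
  ↑ˡ≢null x y eq with () ← trans (sym (FP.splitAt-↑ˡ (a * 2) x m))
                          (trans (cong (splitAt (a * 2)) eq) (FP.splitAt-↑ʳ (a * 2) m y))

  matchEdge∈ : ∀ i → matchEdge i ∈ edges G
  matchEdge∈ i = MP.∈-++⁺ˡ (MP.∈-map⁺ matchEdge (MP.∈-allFin i))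

  joinEdge∈ : ∀ x y → joinEdge x y ∈ edges G
  joinEdge∈ x y = MP.∈-++⁺ʳ (map matchEdge (allFin a))
    (MP.∈-concatMap⁺ (λ x → map (joinEdge x) (allFin m))
      (Any.map (λ { refl → MP.∈-map⁺ (joinEdge x) (MP.∈-allFin y) }) (MP.∈-allFin x)))

  data EdgeView : Vertex × Vertex → Set where
    match : ∀ i → EdgeView (matchEdge i)
    join′ : ∀ x y → EdgeView (joinEdge x y)

  edgeView : ∀ {p} → p ∈ edges G → EdgeView p
  edgeView p∈ with MP.∈-++⁻ (map matchEdge (allFin a)) p∈
  ... | inj₁ p∈match with MP.∈-map⁻ matchEdge p∈match
  ...   | i , _ , refl = match i
  edgeView p∈ | inj₂ p∈join
    with x , p∈row ← Any.satisfied
           (MP.∈-concatMap⁻ (λ x → map (joinEdge x) (allFin m)) {xs = allFin (a * 2)} p∈join)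
    with MP.∈-map⁻ (joinEdge x) p∈row
  ... | y , _ , refl = join′ x y

  data VertexView : Vertex → Set where
    matchedV : ∀ i j → VertexView (matched i j)
    nullV    : ∀ y → VertexView (null y)

  vertexView : ∀ u → VertexView u
  vertexView u with splitAt (a * 2) u | FP.join-splitAt (a * 2) m u
  ... | inj₂ y | refl = nullV y
  ... | inj₁ x | refl with i , j , refl ← FP.combine-surjective {m = a} {n = 2} x = matchedV i j

  lsum-edges : ∀ W → lsum W (edges G)
                     ≡ sumFin a (W ∘ matchEdge) + sumFin (a * 2) (λ x → sumFin m (W ∘ joinEdge x))
  lsum-edges W = begin
    lsum W (edges G)
      ≡⟨ lsum-++ W (map matchEdge (allFin a)) _ ⟩
    lsum W (map matchEdge (allFin a)) + lsum W (concatMap (λ x → map (joinEdge x) (allFin m)) (allFin (a * 2)))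
      ≡⟨ cong₂ _+_ (trans (lsum-map W matchEdge (allFin a)) (lsum-tabulate a _ _))
                   (trans (lsum-concatMap W _ (allFin (a * 2)))
                          (trans (lsum-tabulate (a * 2) _ _) (sumFin-cong (a * 2) λ x →
                            trans (lsum-map W (joinEdge x) (allFin m)) (lsum-tabulate m _ _)))) ⟩
    sumFin a (W ∘ matchEdge) + sumFin (a * 2) (λ x → sumFin m (W ∘ joinEdge x)) ∎
    where open ≡-Reasoning

  size-matchJoinNull : size G ≡ a + a * 2 * m
  size-matchJoinNull = begin
    size G                                                   ≡⟨ ℕP.*-identityʳ (size G) ⟨
    size G * 1                                               ≡⟨ sumFin-const (size G) 1 ⟨
    sumFin (size G) (λ _ → 1)                                ≡⟨ lsum-lookup (λ _ → 1) (edges G) ⟩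
    lsum (λ _ → 1) (edges G)                                 ≡⟨ lsum-edges (λ _ → 1) ⟩
    sumFin a (λ _ → 1) + sumFin (a * 2) (λ _ → sumFin m (λ _ → 1))
      ≡⟨ cong₂ _+_ (sumFin-const a 1)
                   (trans (sumFin-cong (a * 2) (λ _ → sumFin-const m 1)) (sumFin-const (a * 2) (m * 1))) ⟩
    a * 1 + a * 2 * (m * 1)
      ≡⟨ cong₂ (λ s t → s + a * 2 * t) (ℕP.*-identityʳ a) (ℕP.*-identityʳ m) ⟩
    a + a * 2 * m                                            ∎
    where open ≡-Reasoning

  antimagic⇒3≤numColors : Fin a → Fin m → ∀ f → IsLocalAntimagic G f → 3 ≤ numColors G f
  antimagic⇒3≤numColors i y f anti =
    triangle⇒3≤numColors G f anti
      (matchEdge∈ i) (joinEdge∈ (combine i F.zero) y) (joinEdge∈ (combine i (F.suc F.zero)) y)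

  module VertexSums (f : Labeling G) (W : Vertex × Vertex → ℕ) (label≡W : ∀ e → label G f e ≡ W (edge G e)) where

    open IncidentWeight W

    vsum-edges : ∀ u → vsum G f u ≡ sumFin a (incidentWeight u W ∘ matchEdge)
                                     + sumFin (a * 2) (λ x → sumFin m (incidentWeight u W ∘ joinEdge x))
    vsum-edges u = trans (vsum-incidentWeight G f W label≡W u) (lsum-edges (incidentWeight u W))

    vsum-matched : ∀ i₀ j₀ →
                   vsum G f (matched i₀ j₀) ≡ W (matchEdge i₀) + sumFin m (W ∘ joinEdge (combine i₀ j₀))
    vsum-matched i₀ j₀ = trans (vsum-edges u) (cong₂ _+_
      (trans (sumFin-single a i₀ λ i i≢i₀ →
                incidentWeight-≢ u (matchEdge i) (i≢i₀ ∘ same-pair) (i≢i₀ ∘ same-pair))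
             (on-edge j₀))
      (trans (sumFin-single (a * 2) (combine i₀ j₀) λ x x≢ → sumFin-zero m λ y →
                incidentWeight-≢ u (joinEdge x y) (x≢ ∘ FP.↑ˡ-injective m _ _) (↑ˡ≢null _ y ∘ sym))
             (sumFin-cong m λ y → incidentWeight-₁ u (joinEdge (combine i₀ j₀) y) refl)))
      where
      u : Vertex
      u = matched i₀ j₀
      same-pair : ∀ {i j} → matched i j ≡ u → i ≡ i₀
      same-pair eq = proj₁ (FP.combine-injective _ _ _ _ (FP.↑ˡ-injective m _ _ eq))
      on-edge : ∀ j₀ → incidentWeight (matched i₀ j₀) W (matchEdge i₀) ≡ W (matchEdge i₀)
      on-edge F.zero         = incidentWeight-₁ _ (matchEdge i₀) refl
      on-edge (F.suc F.zero) = incidentWeight-₂ _ (matchEdge i₀) refl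

    vsum-null : ∀ y₀ → vsum G f (null y₀) ≡ sumFin (a * 2) (λ x → W (joinEdge x y₀))
    vsum-null y₀ = trans (vsum-edges w) (cong₂ _+_
      (sumFin-zero a λ i → incidentWeight-≢ w (matchEdge i) (↑ˡ≢null _ y₀) (↑ˡ≢null _ y₀))
      (sumFin-cong (a * 2) λ x →
        trans (sumFin-single m y₀ λ y y≢y₀ →
                 incidentWeight-≢ w (joinEdge x y) (↑ˡ≢null x y₀) (y≢y₀ ∘ FP.↑ʳ-injective (a * 2) _ _))
              (incidentWeight-₂ w (joinEdge x y₀) refl)))
      where
      w : Vertex
      w = null y₀

upperColour lowerColour nullColour : ℕ → ℕ → ℕ
upperColour a n = 2 * a * n * n + 4 * a * n + a + n + 1
lowerColour a n = 6 * a * n * n + 4 * a * n + n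
nullColour  a n = 4 * a * a * n + a

upper<lower : ∀ a′ n′ → upperColour (suc a′) (suc n′) < lowerColour (suc a′) (suc n′)
upper<lower a′ n′ = subst (upperColour (suc a′) (suc n′) <_) (difference a′ n′) (ℕP.m<m+n _ (s≤s z≤n))
  where
  difference : ∀ a′ n′ → let a = suc a′ ; n = suc n′ in
    (2 * a * n * n + 4 * a * n + a + n + 1) + suc (4 * a * (n′ * n′ + 2 * n′) + 3 * a′ + 1)
    ≡ 6 * a * n * n + 4 * a * n + n
  difference = solve-∀

-- Equality forces n ∣ 1, then 3a + 1 = 2a², so a ∣ 1, and a = 1 fails.
upper≢null : ∀ a n → upperColour a n ≢ nullColour a n
upper≢null a n A≡C = a≢1 a≡1 a-factored
  where
  factored : n * (2 * a * n + 4 * a + 1) + 1 ≡ n * (4 * a * a)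
  factored = ℕP.+-cancelʳ-≡ a _ _ (trans (split₁ a n) (trans A≡C (split₂ a n)))
    where
    split₁ : ∀ a n → n * (2 * a * n + 4 * a + 1) + 1 + a ≡ 2 * a * n * n + 4 * a * n + a + n + 1
    split₁ = solve-∀
    split₂ : ∀ a n → 4 * a * a * n + a ≡ n * (4 * a * a) + a
    split₂ = solve-∀
  n≡1 : n ≡ 1
  n≡1 = ∣1⇒≡1 (∣m+n∣m⇒∣n (subst (n ∣_) (sym factored) (m∣m*n (4 * a * a))) (m∣m*n (2 * a * n + 4 * a + 1)))
  a-factored : a * 3 + 1 ≡ a * (2 * a)
  a-factored = ℕP.*-cancelˡ-≡ _ _ 2 (trans (split₁ a) (trans n=1 (split₂ a)))
    where
    split₁ : ∀ a → 2 * (a * 3 + 1) ≡ 1 * (2 * a * 1 + 4 * a + 1) + 1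
    split₁ = solve-∀
    split₂ : ∀ a → 1 * (4 * a * a) ≡ 2 * (a * (2 * a))
    split₂ = solve-∀
    n=1 : 1 * (2 * a * 1 + 4 * a + 1) + 1 ≡ 1 * (4 * a * a)
    n=1 = subst (λ n → n * (2 * a * n + 4 * a + 1) + 1 ≡ n * (4 * a * a)) n≡1 factored
  a≡1 : a ≡ 1
  a≡1 = ∣1⇒≡1 (∣m+n∣m⇒∣n (subst (a ∣_) (sym a-factored) (m∣m*n (2 * a))) (m∣m*n 3))
  a≢1 : ∀ {a} → a ≡ 1 → a * 3 + 1 ≢ a * (2 * a)
  a≢1 refl ()

-- Equality forces a ∣ n, hence a ≤ n and nullColour a n = a (4an + 1) ≤ n (4an + 1) < lowerColour a n.
lower≢null : ∀ a′ n′ → lowerColour (suc a′) (suc n′) ≢ nullColour (suc a′) (suc n′)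
lower≢null a′ n′ B≡C = ℕP.<-irrefl (sym B≡C) C<B
  where
  a n : ℕ
  a = suc a′
  n = suc n′
  a∣n : a ∣ n
  a∣n = ∣m+n∣m⇒∣n (subst (a ∣_) (trans (split₂ a n) (trans (sym B≡C) (split₁ a n))) (m∣m*n (4 * a * n + 1)))
                  (m∣m*n (6 * n * n + 4 * n))
    where
    split₁ : ∀ a n → 6 * a * n * n + 4 * a * n + n ≡ a * (6 * n * n + 4 * n) + n
    split₁ = solve-∀
    split₂ : ∀ a n → a * (4 * a * n + 1) ≡ 4 * a * a * n + a
    split₂ = solve-∀
  C<B : nullColour a n < lowerColour a n
  C<B = begin-strict
    nullColour a n        ≡⟨ split a n ⟩
    a * (4 * a * n + 1)   ≤⟨ ℕP.*-monoˡ-≤ (4 * a * n + 1) (∣⇒≤ a∣n) ⟩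
    n * (4 * a * n + 1)   <⟨ ℕP.m<m+n _ (s≤s z≤n) ⟩
    n * (4 * a * n + 1) + suc (2 * a * n * n + 4 * a′ * n + 4 * n′ + 3)
                          ≡⟨ surplus a′ n′ ⟩
    lowerColour a n       ∎
    where
    open ℕP.≤-Reasoning
    split : ∀ a n → 4 * a * a * n + a ≡ a * (4 * a * n + 1)
    split = solve-∀
    surplus : ∀ a′ n′ → let a = suc a′ ; n = suc n′ in
      n * (4 * a * n + 1) + suc (2 * a * n * n + 4 * a′ * n + 4 * n′ + 3) ≡ 6 * a * n * n + 4 * a * n + n
    surplus = solve-∀

-- The vertex sums in closed form; a is written as c + suc i to get rid of c = a ∸ suc i.
upper-closed-form : ∀ {a} c i n′ → c + suc i ≡ a →
  let n = suc n′ ; m = 2 * n ; r = suc (2 * n′) in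
  suc (a * (2 * m) + i) + (suc (a * r + suc (2 * c)) + (a * (n′ * r) + (suc n′ * i + n′ * c) + r))
  ≡ upperColour a n
upper-closed-form c i n′ refl = identity c i n′
  where
  identity : ∀ c i n′ → let a = c + suc i ; n = suc n′ ; m = 2 * n ; r = suc (2 * n′) in
    suc (a * (2 * m) + i) + (suc (a * r + suc (2 * c)) + (a * (n′ * r) + (suc n′ * i + n′ * c) + r))
    ≡ 2 * a * n * n + 4 * a * n + a + n + 1
  identity = solve-∀

lower-closed-form : ∀ {a} c i n′ → c + suc i ≡ a →
  let n = suc n′ ; m = 2 * n ; r = suc (2 * n′) ; Sα = suc n′ * i + n′ * c in
  suc (a * (2 * m) + i) + suc (a * r + 2 * c) + (r * (a * (2 * m)) + 2 * (Sα + r))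
  ≡ lowerColour a n + (a * (n′ * r) + Sα + r + r * a)
lower-closed-form c i n′ refl = identity c i n′
  where
  identity : ∀ c i n′ →
    let a = c + suc i ; n = suc n′ ; m = 2 * n ; r = suc (2 * n′) ; Sα = suc n′ * i + n′ * c in
    suc (a * (2 * m) + i) + suc (a * r + 2 * c) + (r * (a * (2 * m)) + 2 * (Sα + r))
    ≡ 6 * a * n * n + 4 * a * n + n + (a * (n′ * r) + Sα + r + r * a)
  identity = solve-∀

module Construction (a′ n′ : ℕ) where

  a n m r : ℕ
  a = suc a′
  n = suc n′
  m = 2 * n
  r = suc (2 * n′)

  open MatchJoinNull a m public

  α : ℕ → ℕ → ℕ
  α zero          i = i
  α (suc zero)    i = a ∸ suc i
  α (suc (suc y)) i = α y i

  joinValue : ℕ → Fin 2 → ℕ → ℕ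
  joinValue i j         zero    = a * r + (2 * a ∸ suc (toℕ j + 2 * i))
  joinValue i F.zero    (suc y) = a * y + α y i
  joinValue i (F.suc _) (suc y) = a * (2 * m ∸ suc y) + α y i

  valueOf : Fin (a * 2) ⊎ Fin m → Fin (a * 2) ⊎ Fin m → ℕ
  valueOf (inj₁ x) (inj₁ _) = a * (2 * m) + toℕ (quotient {m = a} 2 x)
  valueOf (inj₁ x) (inj₂ y) = joinValue (toℕ (quotient {m = a} 2 x)) (remainder {m = a} 2 x) (toℕ y)
  valueOf (inj₂ _) _        = 0     -- junk: no edge starts at a null vertex

  value : Fin (V G) × Fin (V G) → ℕ
  value (u , v) = valueOf (splitAt (a * 2) u) (splitAt (a * 2) v)

  value-matchEdge : ∀ i → value (matchEdge i) ≡ a * (2 * m) + toℕ i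
  value-matchEdge i =
    trans (cong₂ valueOf (FP.splitAt-↑ˡ (a * 2) (combine i F.zero) m)
                         (FP.splitAt-↑ˡ (a * 2) (combine i (F.suc F.zero)) m))
          (cong (λ ij → a * (2 * m) + toℕ (proj₁ ij)) (FP.remQuot-combine {n = a} {k = 2} i F.zero))

  value-joinEdge : ∀ (i : Fin a) j y → value (joinEdge (combine i j) y) ≡ joinValue (toℕ i) j (toℕ y)
  value-joinEdge i j y =
    trans (cong₂ valueOf (FP.splitAt-↑ˡ (a * 2) (combine i j) m) (FP.splitAt-↑ʳ (a * 2) m y))
          (cong (λ ij → joinValue (toℕ (proj₁ ij)) (proj₂ ij) (toℕ y)) (FP.remQuot-combine {n = a} {k = 2} i j))

  α-< : ∀ y {i} → i < a → α y i < a
  α-< zero          i<a = i<a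
  α-< (suc zero)    i<a = reflect-< i<a
  α-< (suc (suc y)) i<a = α-< y i<a

  α-involutive : ∀ y {i} → i < a → α y (α y i) ≡ i
  α-involutive zero          i<a = refl
  α-involutive (suc zero)    i<a = reflect-involutive i<a
  α-involutive (suc (suc y)) i<a = α-involutive y i<a

  pred-m≡r : ℕ.pred m ≡ r
  pred-m≡r = ℕP.+-suc n′ (n′ + 0)

  r≤2m : r ≤ 2 * m
  r≤2m = ℕP.≤-trans (ℕP.n≤1+n r) (subst (_≤ 2 * m) (cong suc pred-m≡r) (ℕP.m≤m+n m (m + 0)))

  special-entry : ∀ x → suc (value (joinEdge x F.zero)) ≡ suc (a * r) + (a * 2 ∸ suc (toℕ x))
  special-entry x with i , j , refl ← FP.combine-surjective {m = a} {n = 2} x =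
    cong suc (trans (value-joinEdge i j F.zero)
                    (cong₂ (λ s t → a * r + (s ∸ suc t)) (ℕP.*-comm 2 a)
                           (trans (ℕP.+-comm (toℕ j) _) (sym (FP.toℕ-combine i j)))))

  Hit : ℕ → Set
  Hit t = ∃ λ p → p ∈ edges G × value p ≡ t

  -- m = 2 * suc n′ reduces to suc (ℕ.pred m): a column is either the special column zero or suc y
  -- with y < ℕ.pred m = r.
  column : ∀ {y} → y < ℕ.pred m → Fin m
  column y<k = F.suc (fromℕ< y<k)

  upper-hit : ∀ {b o} → b < r → o < a → Hit (a * b + o)
  upper-hit {b} {o} b<r o<a = joinEdge (combine i F.zero) (column b<k) , joinEdge∈ _ _ , (begin
    value (joinEdge (combine i F.zero) (column b<k))   ≡⟨ value-joinEdge i F.zero (column b<k) ⟩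
    a * toℕ (fromℕ< b<k) + α (toℕ (fromℕ< b<k)) (toℕ i)
      ≡⟨ cong₂ (λ y k → a * y + α y k) (FP.toℕ-fromℕ< b<k) (FP.toℕ-fromℕ< _) ⟩
    a * b + α b (α b o)                                  ≡⟨ cong (a * b +_) (α-involutive b o<a) ⟩
    a * b + o                                            ∎)
    where
    open ≡-Reasoning
    b<k : b < ℕ.pred m
    b<k = subst (b <_) (sym pred-m≡r) b<r
    i : Fin a
    i = fromℕ< (α-< b o<a)

  reflect-upper-block : ∀ {b} → m < b → b < 2 * m → 2 * m ∸ suc b < ℕ.pred m
  reflect-upper-block {b} m<b b<2m = ℕ.s≤s⁻¹ (ℕP.+-cancelʳ-≤ m (suc (suc y)) m (begin
    suc (suc y) + m   ≡⟨ ℕP.+-suc (suc y) m ⟨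
    suc y + suc m     ≡⟨ ℕP.+-suc y (suc m) ⟨
    y + suc (suc m)   ≤⟨ ℕP.+-monoʳ-≤ y (s≤s m<b) ⟩
    y + suc b         ≡⟨ ℕP.m∸n+n≡m b<2m ⟩
    2 * m             ≡⟨ cong (m +_) (ℕP.+-identityʳ m) ⟩
    m + m             ∎))
    where
    open ℕP.≤-Reasoning
    y : ℕ
    y = 2 * m ∸ suc b

  lower-hit : ∀ {b o} → m < b → b < 2 * m → o < a → Hit (a * b + o)
  lower-hit {b} {o} m<b b<2m o<a = joinEdge (combine i (F.suc F.zero)) (column y<k) , joinEdge∈ _ _ , (begin
    value (joinEdge (combine i (F.suc F.zero)) (column y<k))
      ≡⟨ value-joinEdge i (F.suc F.zero) (column y<k) ⟩
    a * (2 * m ∸ suc (toℕ (fromℕ< y<k))) + α (toℕ (fromℕ< y<k)) (toℕ i)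
      ≡⟨ cong₂ (λ y k → a * (2 * m ∸ suc y) + α y k) (FP.toℕ-fromℕ< y<k) (FP.toℕ-fromℕ< _) ⟩
    a * (2 * m ∸ suc y) + α y (α y o)
      ≡⟨ cong₂ (λ s t → a * s + t) (reflect-involutive b<2m) (α-involutive y o<a) ⟩
    a * b + o                          ∎)
    where
    open ≡-Reasoning
    y : ℕ
    y = 2 * m ∸ suc b
    y<k : y < ℕ.pred m
    y<k = reflect-upper-block m<b b<2m
    i : Fin a
    i = fromℕ< (α-< y o<a)

  special-hit : ∀ {s} → s < a * 2 → Hit (a * r + s)
  special-hit {s} s<2a = joinEdge x F.zero , joinEdge∈ _ _ , (begin
    value (joinEdge x F.zero)            ≡⟨ ℕP.suc-injective (special-entry x) ⟩
    a * r + (a * 2 ∸ suc (toℕ x))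
      ≡⟨ cong (λ k → a * r + (a * 2 ∸ suc k)) (FP.toℕ-fromℕ< (reflect-< s<2a)) ⟩
    a * r + (a * 2 ∸ suc (a * 2 ∸ suc s)) ≡⟨ cong (a * r +_) (reflect-involutive s<2a) ⟩
    a * r + s                            ∎)
    where
    open ≡-Reasoning
    x : Fin (a * 2)
    x = fromℕ< (reflect-< s<2a)

  match-hit : ∀ {o} → o < a → Hit (a * (2 * m) + o)
  match-hit o<a = matchEdge i , matchEdge∈ i ,
    trans (value-matchEdge i) (cong (a * (2 * m) +_) (FP.toℕ-fromℕ< o<a))
    where
    i : Fin a
    i = fromℕ< o<a

  middle-hit : ∀ {o} → o < a → Hit (a * m + o)
  middle-hit {o} o<a = subst Hit shift (special-hit (subst (a + o <_) (twice a) (ℕP.+-monoʳ-< a o<a)))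
    where
    twice : ∀ a → a + a ≡ a * 2
    twice = solve-∀
    shift : a * r + (a + o) ≡ a * m + o
    shift = trans (regroup a r o) (cong (λ k → a * suc k + o) (sym pred-m≡r))
      where
      regroup : ∀ a r o → a * r + (a + o) ≡ a * suc r + o
      regroup = solve-∀

  block-hit : ∀ b {o} → o < a → b ≤ 2 * m → Hit (a * b + o)
  block-hit b o<a b≤2m with ℕP.<-cmp b r
  ... | tri< b<r _ _ = upper-hit b<r o<a
  ... | tri≈ _ refl _ = special-hit (ℕP.<-≤-trans o<a (ℕP.m≤m*n a 2))
  ... | tri> _ _ r<b with ℕP.m≤n⇒m<n∨m≡n (subst (_≤ b) (cong suc (sym pred-m≡r)) r<b)
  ...   | inj₂ refl = middle-hit o<a
  ...   | inj₁ m<b with ℕP.m≤n⇒m<n∨m≡n b≤2m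
  ...     | inj₁ b<2m = lower-hit m<b b<2m o<a
  ...     | inj₂ refl = match-hit o<a

  every-value-hit : ∀ t → t < size G → Hit t
  every-value-hit t t<q =
    subst Hit division (block-hit (t / a) (m%n<n t a) (ℕ.s≤s⁻¹ (m<n*o⇒m/o<n t<)))
    where
    t< : t < suc (2 * m) * a
    t< = subst (t <_) (trans size-matchJoinNull (regroup a m)) t<q
      where
      regroup : ∀ a m → a + a * 2 * m ≡ suc (2 * m) * a
      regroup = solve-∀
    division : a * (t / a) + t % a ≡ t
    division = trans (regroup a (t / a) (t % a)) (sym (m≡m%n+[m/n]*n t a))
      where
      regroup : ∀ a q o → a * q + o ≡ o + q * a
      regroup = solve-∀

  labeling : Σ (Labeling G) λ f → ∀ e → label G f e ≡ suc (value (edge G e))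
  labeling = valuation⇒labeling G value every-value-hit

  sum-α-row : ∀ p i → sum< (suc (2 * p)) (λ y → α y i) ≡ suc p * i + p * (a ∸ suc i)
  sum-α-row zero    i = sym (ℕP.+-identityʳ (i + 0))
  sum-α-row (suc p) i = begin
    sum< (suc (2 * suc p)) (λ y → α y i)        ≡⟨ cong (λ k → sum< (suc k) (λ y → α y i)) (ℕP.*-suc 2 p) ⟩
    i + (c + sum< (suc (2 * p)) (λ y → α y i))  ≡⟨ cong (λ s → i + (c + s)) (sum-α-row p i) ⟩
    i + (c + (suc p * i + p * c))               ≡⟨ regroup i c p ⟩
    suc (suc p) * i + suc p * c                 ∎
    where
    open ≡-Reasoning
    c : ℕ
    c = a ∸ suc i
    regroup : ∀ i c p → i + (c + (suc p * i + p * c)) ≡ suc (suc p) * i + suc p * c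
    regroup = solve-∀

  sum-α-column : ∀ y → sum< a (α y) ≡ sum< a (λ i → i)
  sum-α-column zero          = refl
  sum-α-column (suc zero)    = sum<-reverse a
  sum-α-column (suc (suc y)) = sum-α-column y

  sum-upper-regular : ∀ i → sum< r (λ y → suc (joinValue i F.zero (suc y)))
                            ≡ a * (n′ * r) + (suc n′ * i + n′ * (a ∸ suc i)) + r
  sum-upper-regular i =
    trans (sum<-linear r a (λ y → α y i)) (cong₂ (λ s t → a * s + t + r) (sum<-odd n′) (sum-α-row n′ i))

  pair-sum : ∀ i y → y < 2 * m →
             suc (joinValue i F.zero (suc y)) + suc (joinValue i (F.suc F.zero) (suc y)) + a
             ≡ a * (2 * m) + 2 * suc (α y i)
  pair-sum i y y<2m = begin
    suc (a * y + α y i) + suc (a * d + α y i) + a ≡⟨ regroup a y d (α y i) ⟩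
    a * (d + suc y) + 2 * suc (α y i)             ≡⟨ cong (λ k → a * k + 2 * suc (α y i)) (ℕP.m∸n+n≡m y<2m) ⟩
    a * (2 * m) + 2 * suc (α y i)                 ∎
    where
    open ≡-Reasoning
    d : ℕ
    d = 2 * m ∸ suc y
    regroup : ∀ a y d α → suc (a * y + α) + suc (a * d + α) + a ≡ a * (d + suc y) + 2 * suc α
    regroup = solve-∀

  sum-row : ∀ i j → sumFin m (λ y → suc (value (joinEdge (combine i j) y)))
                    ≡ suc (joinValue (toℕ i) j 0) + sum< r (λ y → suc (joinValue (toℕ i) j (suc y)))
  sum-row i j = trans (sumFin-cong m (λ y → cong suc (value-joinEdge i j y)))
                      (cong (λ k → suc (joinValue (toℕ i) j 0) + sum< k (λ y → suc (joinValue (toℕ i) j (suc y))))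
                            pred-m≡r)

  sum-pairs : ∀ i → sum< r (λ y → suc (joinValue i F.zero (suc y)))
                    + sum< r (λ y → suc (joinValue i (F.suc F.zero) (suc y))) + r * a
                    ≡ r * (a * (2 * m)) + 2 * (sum< r (λ y → α y i) + r)
  sum-pairs i = begin
    sum< r U + sum< r L + r * a                     ≡⟨ cong (sum< r U + sum< r L +_) (sumFin-const r a) ⟨
    sum< r U + sum< r L + sumFin r (λ _ → a)
      ≡⟨ cong (_+ sumFin r (λ _ → a)) (sumFin-+ r (U ∘ toℕ) (L ∘ toℕ)) ⟨
    sumFin r (λ y → U (toℕ y) + L (toℕ y)) + sumFin r (λ _ → a)
      ≡⟨ sumFin-+ r (λ y → U (toℕ y) + L (toℕ y)) (λ _ → a) ⟨
    sum< r (λ y → U y + L y + a)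
      ≡⟨ sum<-cong r (λ y y<r → pair-sum i y (ℕP.<-≤-trans y<r r≤2m)) ⟩
    sum< r (λ y → a * (2 * m) + 2 * suc (α y i))
      ≡⟨ sumFin-+ r (λ _ → a * (2 * m)) (λ y → 2 * suc (α (toℕ y) i)) ⟩
    sumFin r (λ _ → a * (2 * m)) + sum< r (λ y → 2 * suc (α y i))
      ≡⟨ cong₂ _+_ (sumFin-const r (a * (2 * m)))
                   (trans (sumFin-*ˡ r 2 (λ y → suc (α (toℕ y) i))) (cong (2 *_) (sum<-linear r 0 (λ y → α y i)))) ⟩
    r * (a * (2 * m)) + 2 * (sum< r (λ y → α y i) + r) ∎
    where
    open ≡-Reasoning
    U L : ℕ → ℕ
    U y = suc (joinValue i F.zero (suc y))
    L y = suc (joinValue i (F.suc F.zero) (suc y))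

  sum-column : ∀ y → sumFin (a * 2) (λ x → suc (value (joinEdge x y))) ≡ nullColour a n
  sum-column F.zero = ℕP.*-cancelˡ-≡ _ _ 2 (ℕP.+-cancelʳ-≡ (a * 2) _ _ (begin
    2 * sumFin (a * 2) (λ x → suc (value (joinEdge x F.zero))) + a * 2
      ≡⟨ cong (λ s → 2 * s + a * 2) (trans (sumFin-cong (a * 2) special-entry)
                                          (sumFin-+ (a * 2) (λ _ → suc (a * r)) (λ x → a * 2 ∸ suc (toℕ x)))) ⟩
    2 * (sumFin (a * 2) (λ _ → suc (a * r)) + sum< (a * 2) (λ x → a * 2 ∸ suc x)) + a * 2
      ≡⟨ cong₂ (λ s t → 2 * (s + t) + a * 2) (sumFin-const (a * 2) (suc (a * r))) (sum<-reverse (a * 2)) ⟩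
    2 * (a * 2 * suc (a * r) + S) + a * 2       ≡⟨ regroup (a * 2 * suc (a * r)) S (a * 2) ⟩
    2 * (a * 2 * suc (a * r)) + (2 * S + a * 2) ≡⟨ cong (2 * (a * 2 * suc (a * r)) +_) (gauss (a * 2)) ⟩
    2 * (a * 2 * suc (a * r)) + a * 2 * (a * 2) ≡⟨ identity a n′ ⟩
    2 * nullColour a n + a * 2                  ∎))
    where
    open ≡-Reasoning
    S : ℕ
    S = sum< (a * 2) (λ x → x)
    regroup : ∀ K S b → 2 * (K + S) + b ≡ 2 * K + (2 * S + b)
    regroup = solve-∀
    identity : ∀ a n′ → let n = suc n′ ; r = suc (2 * n′) in
               2 * (a * 2 * suc (a * r)) + a * 2 * (a * 2) ≡ 2 * (4 * a * a * n + a) + a * 2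
    identity = solve-∀
  sum-column (F.suc y) = ℕP.+-cancelʳ-≡ (a * a) _ _ (begin
    sumFin (a * 2) g + a * a                                  ≡⟨ cong (_+ a * a) (sumFin-combine a 2 g) ⟩
    sumFin a (λ i → sumFin 2 (λ j → g (combine i j))) + a * a ≡⟨ cong (_+ a * a) (sumFin-cong a entries) ⟩
    sum< a (λ k → U k + L k) + a * a                          ≡⟨ cong (sum< a (λ k → U k + L k) +_) (sumFin-const a a) ⟨
    sum< a (λ k → U k + L k) + sumFin a (λ _ → a)             ≡⟨ sumFin-+ a (λ k → U (toℕ k) + L (toℕ k)) (λ _ → a) ⟨
    sum< a (λ k → U k + L k + a)                              ≡⟨ sumFin-cong a (λ k → pair-sum (toℕ k) y′ y′<2m) ⟩
    sum< a (λ k → a * (2 * m) + 2 * suc (α y′ k))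
      ≡⟨ sumFin-+ a (λ _ → a * (2 * m)) (λ k → 2 * suc (α y′ (toℕ k))) ⟩
    sumFin a (λ _ → a * (2 * m)) + sum< a (λ k → 2 * suc (α y′ k))
      ≡⟨ cong₂ _+_ (sumFin-const a (a * (2 * m)))
                   (trans (sumFin-*ˡ a 2 (λ k → suc (α y′ (toℕ k)))) (cong (2 *_) (sum<-linear a 0 (α y′)))) ⟩
    a * (a * (2 * m)) + 2 * (sum< a (α y′) + a)
      ≡⟨ cong (λ s → a * (a * (2 * m)) + 2 * (s + a)) (sum-α-column y′) ⟩
    a * (a * (2 * m)) + 2 * (S + a)                           ≡⟨ regroup (a * (a * (2 * m))) S a ⟩
    a * (a * (2 * m)) + a + (2 * S + a)                       ≡⟨ cong (a * (a * (2 * m)) + a +_) (gauss a) ⟩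
    a * (a * (2 * m)) + a + a * a                             ≡⟨ identity a n′ ⟩
    nullColour a n + a * a                                    ∎)
    where
    open ≡-Reasoning
    y′ : ℕ
    y′ = toℕ y
    y′<2m : y′ < 2 * m
    y′<2m = ℕP.<-≤-trans (subst (y′ <_) pred-m≡r (FP.toℕ<n y)) r≤2m
    g : Fin (a * 2) → ℕ
    g x = suc (value (joinEdge x (F.suc y)))
    U L : ℕ → ℕ
    U k = suc (joinValue k F.zero (suc y′))
    L k = suc (joinValue k (F.suc F.zero) (suc y′))
    entries : ∀ i → sumFin 2 (λ j → g (combine i j)) ≡ U (toℕ i) + L (toℕ i)
    entries i = trans (cong₂ (λ s t → suc s + (suc t + 0)) (value-joinEdge i F.zero (F.suc y))
                                                         (value-joinEdge i (F.suc F.zero) (F.suc y)))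
                      (cong (U (toℕ i) +_) (ℕP.+-identityʳ (L (toℕ i))))
    S : ℕ
    S = sum< a (λ k → k)
    regroup : ∀ K S a → K + 2 * (S + a) ≡ K + a + (2 * S + a)
    regroup = solve-∀
    identity : ∀ a n′ → let n = suc n′ ; m = 2 * n in
               a * (a * (2 * m)) + a + a * a ≡ 4 * a * a * n + a + a * a
    identity = solve-∀

  module ColourSums (f : Labeling G) (label≡ : ∀ e → label G f e ≡ suc (value (edge G e))) where
    open VertexSums f (suc ∘ value) label≡

    vsum-matched-joinValue : ∀ (i : Fin a) j → vsum G f (matched i j)
                  ≡ suc (a * (2 * m) + toℕ i)
                    + (suc (joinValue (toℕ i) j 0) + sum< r (λ y → suc (joinValue (toℕ i) j (suc y))))
    vsum-matched-joinValue i j = trans (vsum-matched i j) (cong₂ (λ s t → suc s + t) (value-matchEdge i) (sum-row i j))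

    upper-colour : ∀ i → vsum G f (matched i F.zero) ≡ upperColour a n
    upper-colour i = begin
      vsum G f (matched i F.zero)                                               ≡⟨ vsum-matched-joinValue i F.zero ⟩
      suc (a * (2 * m) + k) + (suc (a * r + (2 * a ∸ suc (2 * k))) + sum< r U)
        ≡⟨ cong₂ (λ s t → suc (a * (2 * m) + k) + (suc (a * r + s) + t)) (reflect-even k<a) (sum-upper-regular k) ⟩
      suc (a * (2 * m) + k) + (suc (a * r + suc (2 * c)) + (a * (n′ * r) + (suc n′ * k + n′ * c) + r))
        ≡⟨ upper-closed-form c k n′ (ℕP.m∸n+n≡m k<a) ⟩
      upperColour a n                                                           ∎
      where
      open ≡-Reasoning
      k c : ℕ
      k = toℕ i
      c = a ∸ suc k
      k<a : k < a
      k<a = FP.toℕ<n i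
      U : ℕ → ℕ
      U y = suc (joinValue k F.zero (suc y))

    lower-colour : ∀ i → vsum G f (matched i (F.suc F.zero)) ≡ lowerColour a n
    -- The upper regular row is added to both sides so that the lower row is summed through sum-pairs.
    lower-colour i = ℕP.+-cancelʳ-≡ (sum< r U + r * a) _ _ (begin
      vsum G f (matched i (F.suc F.zero)) + (sum< r U + r * a)
        ≡⟨ cong (_+ (sum< r U + r * a)) (vsum-matched-joinValue i (F.suc F.zero)) ⟩
      suc (a * (2 * m) + k) + (suc (a * r + (2 * a ∸ suc (suc (2 * k)))) + sum< r L) + (sum< r U + r * a)
        ≡⟨ regroup (suc (a * (2 * m) + k)) (suc (a * r + (2 * a ∸ suc (suc (2 * k))))) (sum< r L) (sum< r U) (r * a) ⟩
      suc (a * (2 * m) + k) + suc (a * r + (2 * a ∸ suc (suc (2 * k)))) + (sum< r U + sum< r L + r * a)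
        ≡⟨ cong₂ (λ s t → suc (a * (2 * m) + k) + suc (a * r + s) + t) (reflect-odd k<a) (sum-pairs k) ⟩
      suc (a * (2 * m) + k) + suc (a * r + 2 * c) + (r * (a * (2 * m)) + 2 * (sum< r (λ y → α y k) + r))
        ≡⟨ cong (λ s → suc (a * (2 * m) + k) + suc (a * r + 2 * c) + (r * (a * (2 * m)) + 2 * (s + r))) (sum-α-row n′ k) ⟩
      suc (a * (2 * m) + k) + suc (a * r + 2 * c) + (r * (a * (2 * m)) + 2 * (Sα + r))
        ≡⟨ lower-closed-form c k n′ (ℕP.m∸n+n≡m k<a) ⟩
      lowerColour a n + (a * (n′ * r) + Sα + r + r * a)
        ≡⟨ cong (λ s → lowerColour a n + (s + r * a)) (sum-upper-regular k) ⟨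
      lowerColour a n + (sum< r U + r * a)                                      ∎)
      where
      open ≡-Reasoning
      k c Sα : ℕ
      k = toℕ i
      c = a ∸ suc k
      Sα = suc n′ * k + n′ * c
      k<a : k < a
      k<a = FP.toℕ<n i
      U L : ℕ → ℕ
      U y = suc (joinValue k F.zero (suc y))
      L y = suc (joinValue k (F.suc F.zero) (suc y))
      regroup : ∀ p q x y z → p + (q + x) + (y + z) ≡ p + q + (y + x + z)
      regroup = solve-∀

    null-colour : ∀ y → vsum G f (null y) ≡ nullColour a n
    null-colour y = trans (vsum-null y) (sum-column y)

    colourValues : List ℕ
    colourValues = upperColour a n ∷ lowerColour a n ∷ nullColour a n ∷ []

    vsum∈colourValues : ∀ u → vsum G f u ∈ colourValues
    vsum∈colourValues u with vertexView u
    ... | matchedV i F.zero         = here (upper-colour i)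
    ... | matchedV i (F.suc F.zero) = there (here (lower-colour i))
    ... | nullV y                   = there (there (here (null-colour y)))

    colours-distinct : Unique colourValues
    colours-distinct =
      (ℕP.<⇒≢ (upper<lower a′ n′) ∷ upper≢null a n ∷ []) ∷ (lower≢null a′ n′ ∷ []) ∷ [] ∷ []

    numColors≡3 : numColors G f ≡ 3
    numColors≡3 = ℕP.≤-antisym (numColors-≤ G f colourValues vsum∈colourValues)
                               (≤-numColors G f colourValues colours-distinct λ
      { (here refl)                 → matched F.zero F.zero , upper-colour F.zero
      ; (there (here refl))         → matched F.zero (F.suc F.zero) , lower-colour F.zero
      ; (there (there (here refl))) → null F.zero , null-colour F.zero })

    matched≢null : ∀ i j y → vsum G f (matched i j) ≢ vsum G f (null y)
    matched≢null i F.zero         y eq = upper≢null a n (trans (sym (upper-colour i)) (trans eq (null-colour y)))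
    matched≢null i (F.suc F.zero) y eq = lower≢null a′ n′ (trans (sym (lower-colour i)) (trans eq (null-colour y)))

    antimagic : IsLocalAntimagic G f
    antimagic = antimagic-intro G f λ p∈ → endpoints-differ (edgeView p∈)
      where
      endpoints-differ : ∀ {p} → EdgeView p → vsum G f (proj₁ p) ≢ vsum G f (proj₂ p)
      endpoints-differ (match i) eq =
        ℕP.<⇒≢ (upper<lower a′ n′) (trans (sym (upper-colour i)) (trans eq (lower-colour i)))
      endpoints-differ (join′ x y) with i , j , refl ← FP.combine-surjective {m = a} {n = 2} x = matched≢null i j y

  chiLa≡3 : ChiLaIs G 3
  chiLa≡3 = (f , antimagic , numColors≡3) , antimagic⇒3≤numColors F.zero F.zero
    where
    f : Labeling G
    f = proj₁ labeling
    open ColourSums f (proj₂ labeling)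

chiLa-matchJoinNull : ∀ a n → 1 ≤ a → 1 ≤ n → ChiLaIs (matchJoinNull a (2 * n)) 3
chiLa-matchJoinNull (suc a′) (suc n′) _ _ = Construction.chiLa≡3 a′ n′

theorem2p1 : (k n : ℕ) → 1 ≤ k → 1 ≤ n → ChiLaIs (matchJoinNull (2 * k) (2 * n)) 3
theorem2p1 k n 1≤k = chiLa-matchJoinNull (2 * k) n (ℕP.≤-trans 1≤k (ℕP.m≤n*m k 2))
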